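{- For every rational number $r$ with $\tfrac12<r<1$, there exists $u\in\mathbb{N}$ such that $\frac{s_3(u^2)}{s_3(u)}=r$.
   Context: $s_3(n)$ denotes the sum of the digits of $n$ in base $3$. -}

module Defs where

open import Data.Nat using (ℕ; zero; suc; _/_; _%_)
open import Data.Nat.Base using (_+_)

-- Sum of base-3 digits, with fuel (fuel ≥ n suffices since n/3 < n for n ≥ 1).
s3-aux : ℕ → ℕ → ℕ
s3-aux zero       n = 0
s3-aux (suc fuel) zero = 0
s3-aux (suc fuel) n@(suc _) = n % 3 + s3-aux fuel (n / 3)

s3 : ℕ → ℕ
s3 n = s3-aux n n

module Submission where

-- For ½ < p/q < 1 (in lowest terms) we exhibit u with s₃(u²) = 8p and
-- s₃(u) = 8q; then s₃(u²)/s₃(u) = 8p/8q = p/q.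
--
-- The numbers involved are described by their base-3 digit strings, written as
-- lists of runs (a digit repeated some number of times).  For a string of runs
-- the digit sum is read off directly (s3-number), while the value is a
-- polynomial in the quantities 3^k, which equal 1 + 22…2 (k twos).
--
-- For run lengths m, t the number u(m,t) with digits (least significant first)
--   2^m 2 2 2 2^t 0 2 2^m
-- has as square the number with digits
--   1 0^m 0 0 0^t 1 1 0^m 1 2^t 0 1 0^m 2 1 2^m,
-- a polynomial identity in x = 3^m − 1 and y = 3^t − 1 (square-u).  So
-- s₃(u) = 2(2m + t + 4) and s₃(u²) = 2(m + t + 4).  Writing p = 2 + e + d and
-- q = 3 + 2e + d, which is possible whenever p < q < 2p, the choice
-- m = 4(e + 1), t = 4d gives s₃(u²) = 8p and s₃(u) = 8q (realise).

open import Defs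
open import Data.Nat
  using (ℕ; zero; suc; _+_; _*_; _^_; _≤_; z≤n; s≤s; s≤s⁻¹; _%_; NonZero)
import Data.Nat as ℕ
open import Data.Nat.Properties
  using (≤-refl; <-≤-trans; +-assoc; +-identityʳ; *-identityˡ; *-identityʳ; *-comm;
         +-cancelˡ-≡; m≤n⇒∃[o]m+o≡n)
open import Data.Nat.DivMod
  using (m/n<m; [m+kn]%n≡m%n; m<n⇒m%n≡m; m<n⇒m/n≡0; m*n/n≡m; +-distrib-/-∣ʳ)
open import Data.Nat.Divisibility using (n∣m*n)
open import Data.Nat.Coprimality using (Coprime)
open import Data.Nat.Tactic.RingSolver using (solve-∀; solve)
open import Data.Fin using (Fin; toℕ; #_)
open import Data.Fin.Properties using (toℕ<n)
open import Data.List using (List; []; _∷_)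
open import Data.Integer using (+_; -[1+_])
import Data.Integer as ℤ
open import Data.Integer.Properties using (pos-*; drop‿+<+)
open import Data.Rational using (ℚ; mkℚ; _<_; _/_; ½; 1ℚ; *<*)
open import Data.Rational.Properties using (fromℚᵘ-cong; /-cong; ↥p/↧p≡p)
open import Data.Rational.Unnormalised using (mkℚᵘ; *≡*)
open import Data.Product using (Σ; ∃; ∃₂; _×_; _,_)
open import Function using (_∘_)
open import Relation.Binary.PropositionalEquality
  using (_≡_; refl; sym; trans; cong; cong₂; subst; subst₂; module ≡-Reasoning)

open ≡-Reasoning

s3-aux-fuel : ∀ f g n → n ≤ f → n ≤ g → s3-aux f n ≡ s3-aux g n
s3-aux-fuel zero    zero    zero    _   _   = refl
s3-aux-fuel zero    (suc g) zero    _   _   = refl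
s3-aux-fuel (suc f) zero    zero    _   _   = refl
s3-aux-fuel (suc f) (suc g) zero    _   _   = refl
s3-aux-fuel (suc f) (suc g) (suc k) k<f k<g =
  cong (λ s → suc k % 3 + s) (s3-aux-fuel f g (suc k ℕ./ 3) (shrink k<f) (shrink k<g))
  where
  shrink : ∀ {h} → suc k ≤ suc h → suc k ℕ./ 3 ≤ h
  shrink le = s≤s⁻¹ (<-≤-trans (m/n<m (suc k) 3 (s≤s (s≤s z≤n))) le)

s3-unfold : ∀ n → s3 n ≡ n % 3 + s3 (n ℕ./ 3)
s3-unfold zero    = refl
s3-unfold (suc k) = cong (λ s → suc k % 3 + s)
  (s3-aux-fuel k (suc k ℕ./ 3) (suc k ℕ./ 3) (s≤s⁻¹ (m/n<m (suc k) 3 (s≤s (s≤s z≤n)))) ≤-refl)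

s3-digit : ∀ d x → d ℕ.< 3 → s3 (d + x * 3) ≡ d + s3 x
s3-digit d x d<3 = begin
  s3 (d + x * 3)                          ≡⟨ s3-unfold (d + x * 3) ⟩
  (d + x * 3) % 3 + s3 ((d + x * 3) ℕ./ 3)  ≡⟨ cong₂ (λ a b → a + s3 b) last-digit quotient ⟩
  d + s3 x                                ∎
  where
  last-digit : (d + x * 3) % 3 ≡ d
  last-digit = trans ([m+kn]%n≡m%n d x 3) (m<n⇒m%n≡m d<3)
  quotient : (d + x * 3) ℕ./ 3 ≡ x
  quotient = begin
    (d + x * 3) ℕ./ 3    ≡⟨ +-distrib-/-∣ʳ d (n∣m*n x) ⟩
    d ℕ./ 3 + x * 3 ℕ./ 3  ≡⟨ cong₂ _+_ (m<n⇒m/n≡0 d<3) (m*n/n≡m x 3) ⟩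
    x                  ∎

block : ℕ → ℕ → ℕ
block d zero    = 0
block d (suc k) = d + block d k * 3

-- A run of k copies of one base-3 digit; digit strings are lists of runs,
-- least significant run first.
data Run : Set where
  run : Fin 3 → ℕ → Run

number : List Run → ℕ
number []             = 0
number (run d k ∷ ws) = block (toℕ d) k + number ws * 3 ^ k

digitSum : List Run → ℕ
digitSum []             = 0
digitSum (run d k ∷ ws) = k * toℕ d + digitSum ws

s3-block : ∀ d k n → d ℕ.< 3 → s3 (block d k + n * 3 ^ k) ≡ k * d + s3 n
s3-block d zero    n d<3 = cong s3 (*-identityʳ n)
s3-block d (suc k) n d<3 = begin
  s3 (block d (suc k) + n * 3 ^ suc k)  ≡⟨ cong s3 (shift d (block d k) n (3 ^ k)) ⟩
  s3 (d + (block d k + n * 3 ^ k) * 3)  ≡⟨ s3-digit d (block d k + n * 3 ^ k) d<3 ⟩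
  d + s3 (block d k + n * 3 ^ k)        ≡⟨ cong (λ s → d + s) (s3-block d k n d<3) ⟩
  d + (k * d + s3 n)                    ≡⟨ sym (+-assoc d (k * d) (s3 n)) ⟩
  suc k * d + s3 n                      ∎
  where
  shift : ∀ d b n p → d + b * 3 + n * (3 * p) ≡ d + (b + n * p) * 3
  shift = solve-∀

s3-number : ∀ ws → s3 (number ws) ≡ digitSum ws
s3-number []             = refl
s3-number (run d k ∷ ws) = begin
  s3 (block (toℕ d) k + number ws * 3 ^ k)  ≡⟨ s3-block (toℕ d) k (number ws) (toℕ<n d) ⟩
  k * toℕ d + s3 (number ws)                ≡⟨ cong (λ s → k * toℕ d + s) (s3-number ws) ⟩
  k * toℕ d + digitSum ws                   ∎

block-zeros : ∀ k → block 0 k ≡ 0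
block-zeros zero    = refl
block-zeros (suc k) = cong (_* 3) (block-zeros k)

pow-twos : ∀ k → 3 ^ k ≡ 1 + block 2 k
pow-twos zero    = refl
pow-twos (suc k) = trans (cong (3 *_) (pow-twos k)) (carry (block 2 k))
  where
  carry : ∀ b → 3 * (1 + b) ≡ 1 + (2 + b * 3)
  carry = solve-∀

u-runs : ℕ → ℕ → List Run
u-runs m t = run (# 2) m ∷ run (# 2) 3 ∷ run (# 2) t ∷ run (# 0) 1 ∷ run (# 2) 1 ∷ run (# 2) m ∷ []

u²-runs : ℕ → ℕ → List Run
u²-runs m t =
  run (# 1) 1 ∷ run (# 0) m ∷ run (# 0) 2 ∷ run (# 0) t ∷ run (# 1) 2 ∷ run (# 0) m ∷
  run (# 1) 1 ∷ run (# 2) t ∷ run (# 0) 1 ∷ run (# 1) 1 ∷ run (# 0) m ∷ run (# 2) 1 ∷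
  run (# 1) 1 ∷ run (# 2) m ∷ []

-- Replacing runs of zeros
-- by 0 and 3^m, 3^t by 1 + x, 1 + y (x, y the runs of twos) turns both sides into
-- polynomials in x and y, which agree: with a = 3^m, b = 3^t one has
-- u = 243a²b − 54ab − 1.
square-u : ∀ m t → number (u-runs m t) * number (u-runs m t) ≡ number (u²-runs m t)
square-u m t rewrite block-zeros m | block-zeros t | pow-twos m | pow-twos t
  with block 2 m | block 2 t
... | x | y = solve (x ∷ y ∷ [])

s3-u : ∀ m t → s3 (number (u-runs m t)) ≡ 2 * (2 * m + t + 4)
s3-u m t = trans (s3-number (u-runs m t)) (count m t)
  where
  count : ∀ m t → m * 2 + (3 * 2 + (t * 2 + (1 * 0 + (1 * 2 + (m * 2 + 0)))))
                ≡ 2 * (2 * m + t + 4)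
  count = solve-∀

s3-u² : ∀ m t → s3 (number (u²-runs m t)) ≡ 2 * (m + t + 4)
s3-u² m t = trans (s3-number (u²-runs m t)) (count m t)
  where
  count : ∀ m t → 1 * 1 + (m * 0 + (2 * 0 + (t * 0 + (2 * 1 + (m * 0 + (1 * 1 + (t * 2
                + (1 * 0 + (1 * 1 + (m * 0 + (1 * 2 + (1 * 1 + (m * 2 + 0)))))))))))))
                ≡ 2 * (m + t + 4)
  count = solve-∀

between-form : ∀ p q → p ℕ.< q → q ℕ.< 2 * p →
               ∃₂ λ e d → p ≡ 2 + e + d × q ≡ 3 + 2 * e + d
between-form p q p<q q<2p with m≤n⇒∃[o]m+o≡n p<q
... | e , refl with m≤n⇒∃[o]m+o≡n q<2p
... | d , q+d≡2p = e , d , p≡ , q≡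
  where
  p≡ : p ≡ 2 + e + d
  p≡ = sym (+-cancelˡ-≡ p (2 + e + d) p (begin
    p + (2 + e + d)      ≡⟨ solve (p ∷ e ∷ d ∷ []) ⟩
    suc (suc p + e) + d  ≡⟨ q+d≡2p ⟩
    2 * p                ≡⟨ cong (λ s → p + s) (+-identityʳ p) ⟩
    p + p                ∎))
  q≡ : suc p + e ≡ 3 + 2 * e + d
  q≡ = begin
    suc p + e            ≡⟨ cong (λ p → suc p + e) p≡ ⟩
    suc (2 + e + d) + e  ≡⟨ solve (e ∷ d ∷ []) ⟩
    3 + 2 * e + d        ∎

realise : ∀ p q → p ℕ.< q → q ℕ.< 2 * p → ∃ λ u → s3 (u * u) ≡ 8 * p × s3 u ≡ 8 * q
realise p q p<q q<2p with between-form p q p<q q<2p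
... | e , d , refl , refl = u , sum-of-square , sum-of-u
  where
  m t u : ℕ
  m = 4 * suc e
  t = 4 * d
  u = number (u-runs m t)
  sum-of-square : s3 (u * u) ≡ 8 * (2 + e + d)
  sum-of-square = begin
    s3 (u * u)                          ≡⟨ cong s3 (square-u m t) ⟩
    s3 (number (u²-runs m t))           ≡⟨ s3-u² m t ⟩
    2 * (4 * suc e + 4 * d + 4)         ≡⟨ solve (e ∷ d ∷ []) ⟩
    8 * (2 + e + d)                     ∎
  sum-of-u : s3 u ≡ 8 * (3 + 2 * e + d)
  sum-of-u = begin
    s3 u                                ≡⟨ s3-u m t ⟩
    2 * (2 * (4 * suc e) + 4 * d + 4)   ≡⟨ solve (e ∷ d ∷ []) ⟩
    8 * (3 + 2 * e + d)                 ∎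

pos-*-< : ∀ a b c d → + a ℤ.* + b ℤ.< + c ℤ.* + d → a * b ℕ.< c * d
pos-*-< a b c d = drop‿+<+ ∘ subst₂ ℤ._<_ (sym (pos-* a b)) (sym (pos-* c d))

half-to-one : ∀ p q-1 .(c : Coprime p (suc q-1)) →
              ½ < mkℚ (+ p) q-1 c → mkℚ (+ p) q-1 c < 1ℚ →
              p ℕ.< suc q-1 × suc q-1 ℕ.< 2 * p
half-to-one p q-1 c (*<* ½<r) (*<* r<1) =
  subst₂ ℕ._<_ (*-identityʳ p) (*-identityˡ (suc q-1)) (pos-*-< p 1 1 (suc q-1) r<1) ,
  subst₂ ℕ._<_ (*-identityˡ (suc q-1)) (*-comm p 2) (pos-*-< 1 (suc q-1) p 2 ½<r)

/-scale : ∀ k p d-1 → (+ (suc k * p)) / (suc k * suc d-1) ≡ (+ p) / suc d-1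
/-scale k p d-1 =
  fromℚᵘ-cong {mkℚᵘ (+ (suc k * p)) (d-1 + k * suc d-1)} {mkℚᵘ (+ p) d-1} (*≡* cross)
  where
  cross : + (suc k * p) ℤ.* + suc d-1 ≡ + p ℤ.* + (suc k * suc d-1)
  cross = begin
    + (suc k * p) ℤ.* + suc d-1    ≡⟨ sym (pos-* (suc k * p) (suc d-1)) ⟩
    + (suc k * p * suc d-1)        ≡⟨ cong +_ (solve (k ∷ p ∷ d-1 ∷ [])) ⟩
    + (p * (suc k * suc d-1))      ≡⟨ pos-* p (suc k * suc d-1) ⟩
    + p ℤ.* + (suc k * suc d-1)    ∎

lemma3p13 : (r : ℚ) → ½ < r → r < 1ℚ →
    ∃ λ (u : ℕ) → Σ (NonZero (s3 u)) λ nz →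
      ((+ s3 (u * u)) / s3 u) {{nz}} ≡ r
lemma3p13 (mkℚ -[1+ n ] q-1 c) (*<* ()) _  -- ½ < r excludes a negative numerator
lemma3p13 r@(mkℚ (+ p) q-1 c) ½<r r<1 with half-to-one p q-1 c ½<r r<1
... | p<q , q<2p with realise p (suc q-1) p<q q<2p
... | u , sum-of-square , sum-of-u = u , nz , (begin
  ((+ s3 (u * u)) / s3 u) {{nz}}  ≡⟨ /-cong {{nz}} (cong +_ sum-of-square) sum-of-u ⟩
  (+ (8 * p)) / (8 * suc q-1)    ≡⟨ /-scale 7 p q-1 ⟩
  (+ p) / suc q-1                ≡⟨ ↥p/↧p≡p r ⟩
  r                              ∎)
  where
  nz : NonZero (s3 u)
  nz = subst NonZero (sym sum-of-u) _
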